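{- If $\Gamma\vdash_{\mathbf{I}} A$, i.e. there is a deduction in $\mathbf{I}$ of (an occurrence of) $A$ whose undischarged assumptions are occurrences of formulas in $\Gamma$, then there is a deduction in $\mathbf{I}$ in normal form with an occurrence of $A$ as conclusion and occurrences of some of the formulas in $\Gamma$ as its undischarged assumptions.
   Context: Formulas of intuitionistic propositional logic are built from atomic formulas using the connectives $\bot$ (0-ary), $\land$, $\lor$, $\supset$; $\bot$ is not atomic. The natural deduction system $\mathbf{I}$ has tree-shaped deductions with assumptions at the leaves, grouped into assumption classes (occurrences of the same formula; a rule discharging a class discharges all its members). Rules: - $\land I$: from deductions of $A$, of $B$, and of $C$ from $[A\land B]$, conclude $C$. - $\supset I$: from a deduction of $B$ from $[A]$ and a deduction of $C$ from $[A\supset B]$, conclude $C$. - $\lor I$: from a deduction of $A$ (or of $B$) and a deduction of $C$ from $[A\lor B]$, conclude $C$. - $\land E$: from $A\land B$ and a deduction of $C$ from $[A],[B]$, conclude $C$. - $\supset E$: from $A\supset B$, $A$, and a deduction of $C$ from $[B]$, conclude $C$. - $\lor E$: from $A\lor B$, a deduction of $C$ from $[A]$ and one of $C$ from $[B]$, conclude $C$. - $\bot E$: from $\bot$ conclude $C$. A single assumption occurrence is a deduction. Standing conventions: no vacuous discharge above arbitrary premises; $\bot E$ has atomic conclusions. In elimination rules, $A\land B,A\supset B,A\lor B,\bot$ are major premises and the $C$'s are arbitrary premises; in introduction rules the $C$ is the arbitrary premise and the discharged $A\land B, A\supset B, A\lor B$ are major assumptions discharged. A maximal formula with main operator $\ast$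 is an occurrence of $A\ast B$ that is both the major premise of $\ast E$ and a major assumption discharged by $\ast I$. A segment is a sequence $C_1,\dots,C_n$ ($n>1$) of occurrences of the same formula, each $C_i$ ($i<n$) an arbitrary premise of a rule with conclusion $C_{i+1}$, and $C_n$ not an arbitrary premise. A maximal segment is a segment whose last formula is the major premise of an elimination rule. A deduction is in normal form if it contains no maximal formula and no maximal segment. -}

module Defs where

open import Data.Nat using (ℕ)
open import Data.Bool using (Bool; true; false)
open import Data.List using (List; []; _∷_)
open import Data.List.Membership.Propositional using (_∈_)
open import Data.List.Relation.Unary.Any using (here; there)
open import Data.List.Relation.Unary.All using (All; []; _∷_; lookup)
open import Data.Product using (_×_)
open import Data.Sum using (_⊎_)
open import Relation.Binary.PropositionalEquality using (_≡_; refl)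
open import Relation.Nullary using (¬_)
open import Data.Unit using (⊤)

-- Formulas of intuitionistic propositional logic.
-- ⊥f is the 0-ary connective ⊥ (not atomic); atoms are indexed by ℕ.

infixr 8 _⋀_
infixr 7 _⋁_
infixr 6 _⊃_

data Formula : Set where
  atom : ℕ → Formula
  ⊥f   : Formula
  _⋀_  : Formula → Formula → Formula
  _⋁_  : Formula → Formula → Formula
  _⊃_  : Formula → Formula → Formula

-- The list Γ
-- enumerates the assumption classes that may occur undischarged; a leaf
-- 'hyp x' (x : A ∈ Γ) is an assumption occurrence of A belonging to the
-- class x.  A rule discharging a class binds a new class (de Bruijn
-- style: the premise lives in an extended context), so all occurrences
-- of that class are discharged together.

data Ded (Γ : List Formula) : Formula → Set where
  hyp : ∀ {A} → A ∈ Γ → Ded Γ A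
  ⋀I  : ∀ {A B C} → Ded Γ A → Ded Γ B → Ded (A ⋀ B ∷ Γ) C → Ded Γ C
  ⊃I  : ∀ {A B C} → Ded (A ∷ Γ) B → Ded (A ⊃ B ∷ Γ) C → Ded Γ C
  ⋁I₁ : ∀ {A B C} → Ded Γ A → Ded (A ⋁ B ∷ Γ) C → Ded Γ C
  ⋁I₂ : ∀ {A B C} → Ded Γ B → Ded (A ⋁ B ∷ Γ) C → Ded Γ C
  ⋀E  : ∀ {A B C} → Ded Γ (A ⋀ B) → Ded (A ∷ B ∷ Γ) C → Ded Γ C
  ⊃E  : ∀ {A B C} → Ded Γ (A ⊃ B) → Ded Γ A → Ded (B ∷ Γ) C → Ded Γ C
  ⋁E  : ∀ {A B C} → Ded Γ (A ⋁ B) → Ded (A ∷ Γ) C → Ded (B ∷ Γ) C → Ded Γ C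
  ⊥E  : ∀ n → Ded Γ ⊥f → Ded Γ (atom n)

data Uses {Γ : List Formula} {A : Formula} (x : A ∈ Γ) : ∀ {C} → Ded Γ C → Set where
  u-hyp  : Uses x (hyp x)
  u-⋀I₁  : ∀ {B₁ B₂ C} {d₁ : Ded Γ B₁} {d₂ : Ded Γ B₂} {d₃ : Ded (B₁ ⋀ B₂ ∷ Γ) C} → Uses x d₁ → Uses x (⋀I d₁ d₂ d₃)
  u-⋀I₂  : ∀ {B₁ B₂ C} {d₁ : Ded Γ B₁} {d₂ : Ded Γ B₂} {d₃ : Ded (B₁ ⋀ B₂ ∷ Γ) C} → Uses x d₂ → Uses x (⋀I d₁ d₂ d₃)
  u-⋀I₃  : ∀ {B₁ B₂ C} {d₁ : Ded Γ B₁} {d₂ : Ded Γ B₂} {d₃ : Ded (B₁ ⋀ B₂ ∷ Γ) C} → Uses (there x) d₃ → Uses x (⋀I d₁ d₂ d₃)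
  u-⊃I₁  : ∀ {B₁ B₂ C} {d₁ : Ded (B₁ ∷ Γ) B₂} {d₂ : Ded (B₁ ⊃ B₂ ∷ Γ) C} → Uses (there x) d₁ → Uses x (⊃I d₁ d₂)
  u-⊃I₂  : ∀ {B₁ B₂ C} {d₁ : Ded (B₁ ∷ Γ) B₂} {d₂ : Ded (B₁ ⊃ B₂ ∷ Γ) C} → Uses (there x) d₂ → Uses x (⊃I d₁ d₂)
  u-⋁I₁₁ : ∀ {B₁ B₂ C} {d₁ : Ded Γ B₁} {d₂ : Ded (B₁ ⋁ B₂ ∷ Γ) C} → Uses x d₁ → Uses x (⋁I₁ d₁ d₂)
  u-⋁I₁₂ : ∀ {B₁ B₂ C} {d₁ : Ded Γ B₁} {d₂ : Ded (B₁ ⋁ B₂ ∷ Γ) C} → Uses (there x) d₂ → Uses x (⋁I₁ d₁ d₂)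
  u-⋁I₂₁ : ∀ {B₁ B₂ C} {d₁ : Ded Γ B₂} {d₂ : Ded (B₁ ⋁ B₂ ∷ Γ) C} → Uses x d₁ → Uses x (⋁I₂ d₁ d₂)
  u-⋁I₂₂ : ∀ {B₁ B₂ C} {d₁ : Ded Γ B₂} {d₂ : Ded (B₁ ⋁ B₂ ∷ Γ) C} → Uses (there x) d₂ → Uses x (⋁I₂ d₁ d₂)
  u-⋀E₁  : ∀ {B₁ B₂ C} {d₁ : Ded Γ (B₁ ⋀ B₂)} {d₂ : Ded (B₁ ∷ B₂ ∷ Γ) C} → Uses x d₁ → Uses x (⋀E d₁ d₂)
  u-⋀E₂  : ∀ {B₁ B₂ C} {d₁ : Ded Γ (B₁ ⋀ B₂)} {d₂ : Ded (B₁ ∷ B₂ ∷ Γ) C} → Uses (there (there x)) d₂ → Uses x (⋀E d₁ d₂)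
  u-⊃E₁  : ∀ {B₁ B₂ C} {d₁ : Ded Γ (B₁ ⊃ B₂)} {d₂ : Ded Γ B₁} {d₃ : Ded (B₂ ∷ Γ) C} → Uses x d₁ → Uses x (⊃E d₁ d₂ d₃)
  u-⊃E₂  : ∀ {B₁ B₂ C} {d₁ : Ded Γ (B₁ ⊃ B₂)} {d₂ : Ded Γ B₁} {d₃ : Ded (B₂ ∷ Γ) C} → Uses x d₂ → Uses x (⊃E d₁ d₂ d₃)
  u-⊃E₃  : ∀ {B₁ B₂ C} {d₁ : Ded Γ (B₁ ⊃ B₂)} {d₂ : Ded Γ B₁} {d₃ : Ded (B₂ ∷ Γ) C} → Uses (there x) d₃ → Uses x (⊃E d₁ d₂ d₃)
  u-⋁E₁  : ∀ {B₁ B₂ C} {d₁ : Ded Γ (B₁ ⋁ B₂)} {d₂ : Ded (B₁ ∷ Γ) C} {d₃ : Ded (B₂ ∷ Γ) C} → Uses x d₁ → Uses x (⋁E d₁ d₂ d₃)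
  u-⋁E₂  : ∀ {B₁ B₂ C} {d₁ : Ded Γ (B₁ ⋁ B₂)} {d₂ : Ded (B₁ ∷ Γ) C} {d₃ : Ded (B₂ ∷ Γ) C} → Uses (there x) d₂ → Uses x (⋁E d₁ d₂ d₃)
  u-⋁E₃  : ∀ {B₁ B₂ C} {d₁ : Ded Γ (B₁ ⋁ B₂)} {d₂ : Ded (B₁ ∷ Γ) C} {d₃ : Ded (B₂ ∷ Γ) C} → Uses (there x) d₃ → Uses x (⋁E d₁ d₂ d₃)
  u-⊥E   : ∀ {n} {d₁ : Ded Γ ⊥f} → Uses x d₁ → Uses x (⊥E n d₁)

-- Standing convention: no vacuous discharge above arbitrary premises.
-- Every arbitrary premise must have at least one occurrence of the
-- assumption class(es) discharged above it (for ⋀E: of [A] or of [B]).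
-- Discharge of [A] in the (non-arbitrary) first premise of ⊃I may be
-- vacuous.

NoVac : ∀ {Γ C} → Ded Γ C → Set
NoVac (hyp x)        = ⊤
NoVac (⋀I d₁ d₂ d₃)  = NoVac d₁ × NoVac d₂ × NoVac d₃ × Uses (here refl) d₃
NoVac (⊃I d₁ d₂)     = NoVac d₁ × NoVac d₂ × Uses (here refl) d₂
NoVac (⋁I₁ d₁ d₂)    = NoVac d₁ × NoVac d₂ × Uses (here refl) d₂
NoVac (⋁I₂ d₁ d₂)    = NoVac d₁ × NoVac d₂ × Uses (here refl) d₂
NoVac (⋀E d₁ d₂)     = NoVac d₁ × NoVac d₂ × (Uses (here refl) d₂ ⊎ Uses (there (here refl)) d₂)
NoVac (⊃E d₁ d₂ d₃)  = NoVac d₁ × NoVac d₂ × NoVac d₃ × Uses (here refl) d₃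
NoVac (⋁E d₁ d₂ d₃)  = NoVac d₁ × NoVac d₂ × NoVac d₃ × Uses (here refl) d₂ × Uses (here refl) d₃
NoVac (⊥E n d₁)      = NoVac d₁

-- A marking records, for each assumption class in scope, whether it is
-- a major assumption discharged by an introduction rule (true) or not.
-- A maximal formula is a major premise of ∗E which is an assumption
-- occurrence of a class discharged as major assumption by ∗I.  (The
-- main operator automatically matches, since the class's formula is
-- the discharged A∗B and the major premise of ∗E has main operator ∗.)

Marks : List Formula → Set
Marks = All (λ _ → Bool)

unmarked : (Γ : List Formula) → Marks Γ
unmarked []      = []
unmarked (_ ∷ Γ) = false ∷ unmarked Γ

data HasMaxFormula : ∀ {Γ C} → Marks Γ → Ded Γ C → Set where
  mf-⋀E : ∀ {Γ B₁ B₂ C} {m : Marks Γ} {x : B₁ ⋀ B₂ ∈ Γ} {d₂ : Ded (B₁ ∷ B₂ ∷ Γ) C} →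
          lookup m x ≡ true → HasMaxFormula m (⋀E (hyp x) d₂)
  mf-⊃E : ∀ {Γ B₁ B₂ C} {m : Marks Γ} {x : B₁ ⊃ B₂ ∈ Γ} {d₂ : Ded Γ B₁} {d₃ : Ded (B₂ ∷ Γ) C} →
          lookup m x ≡ true → HasMaxFormula m (⊃E (hyp x) d₂ d₃)
  mf-⋁E : ∀ {Γ B₁ B₂ C} {m : Marks Γ} {x : B₁ ⋁ B₂ ∈ Γ} {d₂ : Ded (B₁ ∷ Γ) C} {d₃ : Ded (B₂ ∷ Γ) C} →
          lookup m x ≡ true → HasMaxFormula m (⋁E (hyp x) d₂ d₃)
  in-⋀I₁ : ∀ {Γ B₁ B₂ C} {m : Marks Γ} {d₁ : Ded Γ B₁} {d₂ : Ded Γ B₂} {d₃ : Ded (B₁ ⋀ B₂ ∷ Γ) C} → HasMaxFormula m d₁ → HasMaxFormula m (⋀I d₁ d₂ d₃)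
  in-⋀I₂ : ∀ {Γ B₁ B₂ C} {m : Marks Γ} {d₁ : Ded Γ B₁} {d₂ : Ded Γ B₂} {d₃ : Ded (B₁ ⋀ B₂ ∷ Γ) C} → HasMaxFormula m d₂ → HasMaxFormula m (⋀I d₁ d₂ d₃)
  in-⋀I₃ : ∀ {Γ B₁ B₂ C} {m : Marks Γ} {d₁ : Ded Γ B₁} {d₂ : Ded Γ B₂} {d₃ : Ded (B₁ ⋀ B₂ ∷ Γ) C} → HasMaxFormula (true ∷ m) d₃ → HasMaxFormula m (⋀I d₁ d₂ d₃)
  in-⊃I₁ : ∀ {Γ B₁ B₂ C} {m : Marks Γ} {d₁ : Ded (B₁ ∷ Γ) B₂} {d₂ : Ded (B₁ ⊃ B₂ ∷ Γ) C} → HasMaxFormula (false ∷ m) d₁ → HasMaxFormula m (⊃I d₁ d₂)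
  in-⊃I₂ : ∀ {Γ B₁ B₂ C} {m : Marks Γ} {d₁ : Ded (B₁ ∷ Γ) B₂} {d₂ : Ded (B₁ ⊃ B₂ ∷ Γ) C} → HasMaxFormula (true ∷ m) d₂ → HasMaxFormula m (⊃I d₁ d₂)
  in-⋁I₁₁ : ∀ {Γ B₁ B₂ C} {m : Marks Γ} {d₁ : Ded Γ B₁} {d₂ : Ded (B₁ ⋁ B₂ ∷ Γ) C} → HasMaxFormula m d₁ → HasMaxFormula m (⋁I₁ d₁ d₂)
  in-⋁I₁₂ : ∀ {Γ B₁ B₂ C} {m : Marks Γ} {d₁ : Ded Γ B₁} {d₂ : Ded (B₁ ⋁ B₂ ∷ Γ) C} → HasMaxFormula (true ∷ m) d₂ → HasMaxFormula m (⋁I₁ d₁ d₂)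
  in-⋁I₂₁ : ∀ {Γ B₁ B₂ C} {m : Marks Γ} {d₁ : Ded Γ B₂} {d₂ : Ded (B₁ ⋁ B₂ ∷ Γ) C} → HasMaxFormula m d₁ → HasMaxFormula m (⋁I₂ d₁ d₂)
  in-⋁I₂₂ : ∀ {Γ B₁ B₂ C} {m : Marks Γ} {d₁ : Ded Γ B₂} {d₂ : Ded (B₁ ⋁ B₂ ∷ Γ) C} → HasMaxFormula (true ∷ m) d₂ → HasMaxFormula m (⋁I₂ d₁ d₂)
  in-⋀E₁ : ∀ {Γ B₁ B₂ C} {m : Marks Γ} {d₁ : Ded Γ (B₁ ⋀ B₂)} {d₂ : Ded (B₁ ∷ B₂ ∷ Γ) C} → HasMaxFormula m d₁ → HasMaxFormula m (⋀E d₁ d₂)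
  in-⋀E₂ : ∀ {Γ B₁ B₂ C} {m : Marks Γ} {d₁ : Ded Γ (B₁ ⋀ B₂)} {d₂ : Ded (B₁ ∷ B₂ ∷ Γ) C} → HasMaxFormula (false ∷ false ∷ m) d₂ → HasMaxFormula m (⋀E d₁ d₂)
  in-⊃E₁ : ∀ {Γ B₁ B₂ C} {m : Marks Γ} {d₁ : Ded Γ (B₁ ⊃ B₂)} {d₂ : Ded Γ B₁} {d₃ : Ded (B₂ ∷ Γ) C} → HasMaxFormula m d₁ → HasMaxFormula m (⊃E d₁ d₂ d₃)
  in-⊃E₂ : ∀ {Γ B₁ B₂ C} {m : Marks Γ} {d₁ : Ded Γ (B₁ ⊃ B₂)} {d₂ : Ded Γ B₁} {d₃ : Ded (B₂ ∷ Γ) C} → HasMaxFormula m d₂ → HasMaxFormula m (⊃E d₁ d₂ d₃)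
  in-⊃E₃ : ∀ {Γ B₁ B₂ C} {m : Marks Γ} {d₁ : Ded Γ (B₁ ⊃ B₂)} {d₂ : Ded Γ B₁} {d₃ : Ded (B₂ ∷ Γ) C} → HasMaxFormula (false ∷ m) d₃ → HasMaxFormula m (⊃E d₁ d₂ d₃)
  in-⋁E₁ : ∀ {Γ B₁ B₂ C} {m : Marks Γ} {d₁ : Ded Γ (B₁ ⋁ B₂)} {d₂ : Ded (B₁ ∷ Γ) C} {d₃ : Ded (B₂ ∷ Γ) C} → HasMaxFormula m d₁ → HasMaxFormula m (⋁E d₁ d₂ d₃)
  in-⋁E₂ : ∀ {Γ B₁ B₂ C} {m : Marks Γ} {d₁ : Ded Γ (B₁ ⋁ B₂)} {d₂ : Ded (B₁ ∷ Γ) C} {d₃ : Ded (B₂ ∷ Γ) C} → HasMaxFormula (false ∷ m) d₂ → HasMaxFormula m (⋁E d₁ d₂ d₃)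
  in-⋁E₃ : ∀ {Γ B₁ B₂ C} {m : Marks Γ} {d₁ : Ded Γ (B₁ ⋁ B₂)} {d₂ : Ded (B₁ ∷ Γ) C} {d₃ : Ded (B₂ ∷ Γ) C} → HasMaxFormula (false ∷ m) d₃ → HasMaxFormula m (⋁E d₁ d₂ d₃)
  in-⊥E  : ∀ {Γ n} {m : Marks Γ} {d₁ : Ded Γ ⊥f} → HasMaxFormula m d₁ → HasMaxFormula m (⊥E n d₁)

-- Segments.
-- e ◁ d : (the conclusion of) e is an arbitrary premise of the last rule
-- of d (whose conclusion is the conclusion of d, the same formula C).

data _◁_ : ∀ {Δ Γ C} → Ded Δ C → Ded Γ C → Set where
  ◁-⋀I  : ∀ {Γ B₁ B₂ C} {d₁ : Ded Γ B₁} {d₂ : Ded Γ B₂} {d₃ : Ded (B₁ ⋀ B₂ ∷ Γ) C} → d₃ ◁ ⋀I d₁ d₂ d₃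
  ◁-⊃I  : ∀ {Γ B₁ B₂ C} {d₁ : Ded (B₁ ∷ Γ) B₂} {d₂ : Ded (B₁ ⊃ B₂ ∷ Γ) C} → d₂ ◁ ⊃I d₁ d₂
  ◁-⋁I₁ : ∀ {Γ B₁ B₂ C} {d₁ : Ded Γ B₁} {d₂ : Ded (B₁ ⋁ B₂ ∷ Γ) C} → d₂ ◁ ⋁I₁ d₁ d₂
  ◁-⋁I₂ : ∀ {Γ B₁ B₂ C} {d₁ : Ded Γ B₂} {d₂ : Ded (B₁ ⋁ B₂ ∷ Γ) C} → d₂ ◁ ⋁I₂ d₁ d₂
  ◁-⋀E  : ∀ {Γ B₁ B₂ C} {d₁ : Ded Γ (B₁ ⋀ B₂)} {d₂ : Ded (B₁ ∷ B₂ ∷ Γ) C} → d₂ ◁ ⋀E d₁ d₂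
  ◁-⊃E  : ∀ {Γ B₁ B₂ C} {d₁ : Ded Γ (B₁ ⊃ B₂)} {d₂ : Ded Γ B₁} {d₃ : Ded (B₂ ∷ Γ) C} → d₃ ◁ ⊃E d₁ d₂ d₃
  ◁-⋁E₁ : ∀ {Γ B₁ B₂ C} {d₁ : Ded Γ (B₁ ⋁ B₂)} {d₂ : Ded (B₁ ∷ Γ) C} {d₃ : Ded (B₂ ∷ Γ) C} → d₂ ◁ ⋁E d₁ d₂ d₃
  ◁-⋁E₂ : ∀ {Γ B₁ B₂ C} {d₁ : Ded Γ (B₁ ⋁ B₂)} {d₂ : Ded (B₁ ∷ Γ) C} {d₃ : Ded (B₂ ∷ Γ) C} → d₃ ◁ ⋁E d₁ d₂ d₃

-- SegmentEndingAt d : the conclusion occurrence of d is the last member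
-- C_n of a segment C_1,…,C_n with n > 1: a chain e₁ ◁ e₂ ◁ … ◁ eₙ = d.
data SegmentEndingAt : ∀ {Γ C} → Ded Γ C → Set where
  seg-two  : ∀ {Δ Γ C} {e : Ded Δ C} {d : Ded Γ C} → e ◁ d → SegmentEndingAt d
  seg-more : ∀ {Δ Γ C} {e : Ded Δ C} {d : Ded Γ C} → e ◁ d → SegmentEndingAt e → SegmentEndingAt d

data HasMaxSegment : ∀ {Γ C} → Ded Γ C → Set where
  ms-⋀E : ∀ {Γ B₁ B₂ C} {d₁ : Ded Γ (B₁ ⋀ B₂)} {d₂ : Ded (B₁ ∷ B₂ ∷ Γ) C} → SegmentEndingAt d₁ → HasMaxSegment (⋀E d₁ d₂)
  ms-⊃E : ∀ {Γ B₁ B₂ C} {d₁ : Ded Γ (B₁ ⊃ B₂)} {d₂ : Ded Γ B₁} {d₃ : Ded (B₂ ∷ Γ) C} → SegmentEndingAt d₁ → HasMaxSegment (⊃E d₁ d₂ d₃)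
  ms-⋁E : ∀ {Γ B₁ B₂ C} {d₁ : Ded Γ (B₁ ⋁ B₂)} {d₂ : Ded (B₁ ∷ Γ) C} {d₃ : Ded (B₂ ∷ Γ) C} → SegmentEndingAt d₁ → HasMaxSegment (⋁E d₁ d₂ d₃)
  ms-⊥E : ∀ {Γ n} {d₁ : Ded Γ ⊥f} → SegmentEndingAt d₁ → HasMaxSegment (⊥E n d₁)
  in-⋀I₁ : ∀ {Γ B₁ B₂ C} {d₁ : Ded Γ B₁} {d₂ : Ded Γ B₂} {d₃ : Ded (B₁ ⋀ B₂ ∷ Γ) C} → HasMaxSegment d₁ → HasMaxSegment (⋀I d₁ d₂ d₃)
  in-⋀I₂ : ∀ {Γ B₁ B₂ C} {d₁ : Ded Γ B₁} {d₂ : Ded Γ B₂} {d₃ : Ded (B₁ ⋀ B₂ ∷ Γ) C} → HasMaxSegment d₂ → HasMaxSegment (⋀I d₁ d₂ d₃)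
  in-⋀I₃ : ∀ {Γ B₁ B₂ C} {d₁ : Ded Γ B₁} {d₂ : Ded Γ B₂} {d₃ : Ded (B₁ ⋀ B₂ ∷ Γ) C} → HasMaxSegment d₃ → HasMaxSegment (⋀I d₁ d₂ d₃)
  in-⊃I₁ : ∀ {Γ B₁ B₂ C} {d₁ : Ded (B₁ ∷ Γ) B₂} {d₂ : Ded (B₁ ⊃ B₂ ∷ Γ) C} → HasMaxSegment d₁ → HasMaxSegment (⊃I d₁ d₂)
  in-⊃I₂ : ∀ {Γ B₁ B₂ C} {d₁ : Ded (B₁ ∷ Γ) B₂} {d₂ : Ded (B₁ ⊃ B₂ ∷ Γ) C} → HasMaxSegment d₂ → HasMaxSegment (⊃I d₁ d₂)
  in-⋁I₁₁ : ∀ {Γ B₁ B₂ C} {d₁ : Ded Γ B₁} {d₂ : Ded (B₁ ⋁ B₂ ∷ Γ) C} → HasMaxSegment d₁ → HasMaxSegment (⋁I₁ d₁ d₂)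
  in-⋁I₁₂ : ∀ {Γ B₁ B₂ C} {d₁ : Ded Γ B₁} {d₂ : Ded (B₁ ⋁ B₂ ∷ Γ) C} → HasMaxSegment d₂ → HasMaxSegment (⋁I₁ d₁ d₂)
  in-⋁I₂₁ : ∀ {Γ B₁ B₂ C} {d₁ : Ded Γ B₂} {d₂ : Ded (B₁ ⋁ B₂ ∷ Γ) C} → HasMaxSegment d₁ → HasMaxSegment (⋁I₂ d₁ d₂)
  in-⋁I₂₂ : ∀ {Γ B₁ B₂ C} {d₁ : Ded Γ B₂} {d₂ : Ded (B₁ ⋁ B₂ ∷ Γ) C} → HasMaxSegment d₂ → HasMaxSegment (⋁I₂ d₁ d₂)
  in-⋀E₁ : ∀ {Γ B₁ B₂ C} {d₁ : Ded Γ (B₁ ⋀ B₂)} {d₂ : Ded (B₁ ∷ B₂ ∷ Γ) C} → HasMaxSegment d₁ → HasMaxSegment (⋀E d₁ d₂)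
  in-⋀E₂ : ∀ {Γ B₁ B₂ C} {d₁ : Ded Γ (B₁ ⋀ B₂)} {d₂ : Ded (B₁ ∷ B₂ ∷ Γ) C} → HasMaxSegment d₂ → HasMaxSegment (⋀E d₁ d₂)
  in-⊃E₁ : ∀ {Γ B₁ B₂ C} {d₁ : Ded Γ (B₁ ⊃ B₂)} {d₂ : Ded Γ B₁} {d₃ : Ded (B₂ ∷ Γ) C} → HasMaxSegment d₁ → HasMaxSegment (⊃E d₁ d₂ d₃)
  in-⊃E₂ : ∀ {Γ B₁ B₂ C} {d₁ : Ded Γ (B₁ ⊃ B₂)} {d₂ : Ded Γ B₁} {d₃ : Ded (B₂ ∷ Γ) C} → HasMaxSegment d₂ → HasMaxSegment (⊃E d₁ d₂ d₃)
  in-⊃E₃ : ∀ {Γ B₁ B₂ C} {d₁ : Ded Γ (B₁ ⊃ B₂)} {d₂ : Ded Γ B₁} {d₃ : Ded (B₂ ∷ Γ) C} → HasMaxSegment d₃ → HasMaxSegment (⊃E d₁ d₂ d₃)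
  in-⋁E₁ : ∀ {Γ B₁ B₂ C} {d₁ : Ded Γ (B₁ ⋁ B₂)} {d₂ : Ded (B₁ ∷ Γ) C} {d₃ : Ded (B₂ ∷ Γ) C} → HasMaxSegment d₁ → HasMaxSegment (⋁E d₁ d₂ d₃)
  in-⋁E₂ : ∀ {Γ B₁ B₂ C} {d₁ : Ded Γ (B₁ ⋁ B₂)} {d₂ : Ded (B₁ ∷ Γ) C} {d₃ : Ded (B₂ ∷ Γ) C} → HasMaxSegment d₂ → HasMaxSegment (⋁E d₁ d₂ d₃)
  in-⋁E₃ : ∀ {Γ B₁ B₂ C} {d₁ : Ded Γ (B₁ ⋁ B₂)} {d₂ : Ded (B₁ ∷ Γ) C} {d₃ : Ded (B₂ ∷ Γ) C} → HasMaxSegment d₃ → HasMaxSegment (⋁E d₁ d₂ d₃)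
  in-⊥E  : ∀ {Γ n} {d₁ : Ded Γ ⊥f} → HasMaxSegment d₁ → HasMaxSegment (⊥E n d₁)

-- Normal form: no maximal formula and no maximal segment.  The
-- undischarged classes (those of Γ) are not discharged by any rule, so
-- they are unmarked.

Normal : ∀ {Γ C} → Ded Γ C → Set
Normal {Γ} d = ¬ HasMaxFormula (unmarked Γ) d × ¬ HasMaxSegment d

-- Normal deductions of I are, up to notation, the cut-free derivations of a
-- G3-style sequent calculus: major premises of eliminations are assumptions,
-- and the arbitrary premise of an introduction is just the assumption it
-- discharges.  Every deduction is evaluated in a Kripke model over contexts
-- built from such derivations, where ⊥ and ∨ are interpreted by a
-- continuation monad (a case distinction on an assumption can only be
-- carried out by a derivation); reading the value back yields a cut-free
-- derivation, whose embedding into I is normal.  Vacuous discharges left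
-- by the read-back are removed beforehand by strengthening, which keeps the
-- derivation cut-free.
module Submission where

open import Defs
open import Data.Bool using (true)
open import Data.Empty using (⊥)
open import Data.List using (List; _∷_)
open import Data.List.Membership.Propositional using (_∈_; _─_)
open import Data.List.Relation.Binary.Subset.Propositional using (_⊆_)
open import Data.List.Relation.Binary.Subset.Propositional.Properties using (⊆-refl; ⊆-trans; ∷⁺ʳ)
open import Data.List.Relation.Unary.All using (lookup)
open import Data.List.Relation.Unary.Any using (here; there)
open import Data.Nat using (ℕ; suc; _+_; _≤_; s≤s)
open import Data.Nat.Properties
  using (≤-refl; ≤-trans; ≤-reflexive; m≤n⇒m≤1+n; m≤m+n; m≤n+m; +-mono-≤; m+n≤o⇒m≤o; m+n≤o⇒n≤o)
open import Data.Product using (Σ; _×_; _,_; proj₁; proj₂)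
open import Data.Sum using (_⊎_; inj₁; inj₂; [_,_]′)
import Data.Sum as Sum
open import Data.Unit using (tt)
open import Relation.Binary.PropositionalEquality using (_≡_; _≢_; refl; cong; cong₂)
open import Relation.Nullary using (¬_)

-- Cut-free derivations

data Nf (Γ : List Formula) : Formula → Set where
  hyp : ∀ {A} → A ∈ Γ → Nf Γ A
  ⋀R  : ∀ {A B} → Nf Γ A → Nf Γ B → Nf Γ (A ⋀ B)
  ⊃R  : ∀ {A B} → Nf (A ∷ Γ) B → Nf Γ (A ⊃ B)
  ⋁R₁ : ∀ {A B} → Nf Γ A → Nf Γ (A ⋁ B)
  ⋁R₂ : ∀ {A B} → Nf Γ B → Nf Γ (A ⋁ B)
  ⋀L  : ∀ {A B C} → A ⋀ B ∈ Γ → Nf (A ∷ B ∷ Γ) C → Nf Γ C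
  ⊃L  : ∀ {A B C} → A ⊃ B ∈ Γ → Nf Γ A → Nf (B ∷ Γ) C → Nf Γ C
  ⋁L  : ∀ {A B C} → A ⋁ B ∈ Γ → Nf (A ∷ Γ) C → Nf (B ∷ Γ) C → Nf Γ C
  ⊥L  : ∀ n → ⊥f ∈ Γ → Nf Γ (atom n)

rename : ∀ {Γ Δ C} → Γ ⊆ Δ → Nf Γ C → Nf Δ C
rename ρ (hyp x)      = hyp (ρ x)
rename ρ (⋀R a b)     = ⋀R (rename ρ a) (rename ρ b)
rename ρ (⊃R d)       = ⊃R (rename (∷⁺ʳ _ ρ) d)
rename ρ (⋁R₁ d)      = ⋁R₁ (rename ρ d)
rename ρ (⋁R₂ d)      = ⋁R₂ (rename ρ d)
rename ρ (⋀L x d)     = ⋀L (ρ x) (rename (∷⁺ʳ _ (∷⁺ʳ _ ρ)) d)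
rename ρ (⊃L x a d)   = ⊃L (ρ x) (rename ρ a) (rename (∷⁺ʳ _ ρ) d)
rename ρ (⋁L x d e)   = ⋁L (ρ x) (rename (∷⁺ʳ _ ρ) d) (rename (∷⁺ʳ _ ρ) e)
rename ρ (⊥L n x)     = ⊥L n (ρ x)

from⊥ : ∀ {Γ} C → ⊥f ∈ Γ → Nf Γ C
from⊥ (atom n) x = ⊥L n x
from⊥ ⊥f       x = hyp x
from⊥ (A ⋀ B)  x = ⋀R (from⊥ A x) (from⊥ B x)
from⊥ (A ⋁ B)  x = ⋁R₁ (from⊥ A x)
from⊥ (A ⊃ B)  x = ⊃R (from⊥ B (there x))

-- Normalisation by evaluation

Cont : (List Formula → Set) → List Formula → Set
Cont P Γ = ∀ C {Δ} → Γ ⊆ Δ → (∀ {Δ′} → Δ ⊆ Δ′ → P Δ′ → Nf Δ′ C) → Nf Δ C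

Cont-mono : ∀ {P Γ Δ} → Γ ⊆ Δ → Cont P Γ → Cont P Δ
Cont-mono ρ k C σ = k C (⊆-trans ρ σ)

Cont-join : ∀ {P Γ} → Cont (Cont P) Γ → Cont P Γ
Cont-join k C ρ κ = k C ρ (λ σ v → v C ⊆-refl (λ τ → κ (⊆-trans σ τ)))

⟦_⟧ : Formula → List Formula → Set
⟦ atom n ⟧ Γ = Nf Γ (atom n)
⟦ ⊥f ⟧       = Cont (λ _ → ⊥)
⟦ A ⋀ B ⟧ Γ  = ⟦ A ⟧ Γ × ⟦ B ⟧ Γ
⟦ A ⋁ B ⟧    = Cont (λ Δ → ⟦ A ⟧ Δ ⊎ ⟦ B ⟧ Δ)
⟦ A ⊃ B ⟧ Γ  = ∀ {Δ} → Γ ⊆ Δ → ⟦ A ⟧ Δ → ⟦ B ⟧ Δ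

⟦⟧-mono : ∀ A {Γ Δ} → Γ ⊆ Δ → ⟦ A ⟧ Γ → ⟦ A ⟧ Δ
⟦⟧-mono (atom n) ρ v       = rename ρ v
⟦⟧-mono ⊥f       ρ v       = Cont-mono ρ v
⟦⟧-mono (A ⋀ B)  ρ (a , b) = ⟦⟧-mono A ρ a , ⟦⟧-mono B ρ b
⟦⟧-mono (A ⋁ B)  ρ v       = Cont-mono ρ v
⟦⟧-mono (A ⊃ B)  ρ f σ     = f (⊆-trans ρ σ)

collapse : ∀ A {Γ} → Cont ⟦ A ⟧ Γ → ⟦ A ⟧ Γ
collapse (atom n) k     = k (atom n) ⊆-refl (λ _ v → v)
collapse ⊥f       k     = Cont-join k
collapse (A ⋀ B)  k     = collapse A (λ C ρ κ → k C ρ (λ σ v → κ σ (proj₁ v)))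
                        , collapse B (λ C ρ κ → k C ρ (λ σ v → κ σ (proj₂ v)))
collapse (A ⋁ B)  k     = Cont-join k
collapse (A ⊃ B)  k ρ a = collapse B (λ C σ κ → k C (⊆-trans ρ σ)
                            (λ τ f → κ τ (f ⊆-refl (⟦⟧-mono A (⊆-trans σ τ) a))))

mutual
  reflect : ∀ A {Γ} → A ∈ Γ → ⟦ A ⟧ Γ
  reflect (atom n) x         = hyp x
  reflect ⊥f       x C ρ κ   = from⊥ C (ρ x)
  reflect (A ⋀ B)  x         = collapse (A ⋀ B) (λ C ρ κ →
    ⋀L (ρ x) (κ (λ y → there (there y)) (reflect A (here refl) , reflect B (there (here refl)))))
  reflect (A ⋁ B)  x C ρ κ   =
    ⋁L (ρ x) (κ there (inj₁ (reflect A (here refl)))) (κ there (inj₂ (reflect B (here refl))))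
  reflect (A ⊃ B)  x ρ a     = collapse B (λ C σ κ →
    ⊃L (σ (ρ x)) (reify A (⟦⟧-mono A σ a)) (κ there (reflect B (here refl))))

  reify : ∀ A {Γ} → ⟦ A ⟧ Γ → Nf Γ A
  reify (atom n) v       = v
  reify ⊥f       v       = v ⊥f ⊆-refl (λ _ ())
  reify (A ⋀ B)  (a , b) = ⋀R (reify A a) (reify B b)
  reify (A ⋁ B)  v       = v (A ⋁ B) ⊆-refl (λ _ → [ (λ a → ⋁R₁ (reify A a)) , (λ b → ⋁R₂ (reify B b)) ]′)
  reify (A ⊃ B)  f       = ⊃R (reify B (f there (reflect A (here refl))))

Env : List Formula → List Formula → Set
Env Γ Δ = ∀ {A} → A ∈ Γ → ⟦ A ⟧ Δ

infixr 5 _∷ₑ_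
_∷ₑ_ : ∀ {Γ Δ A} → ⟦ A ⟧ Δ → Env Γ Δ → Env (A ∷ Γ) Δ
(v ∷ₑ η) (here refl) = v
(v ∷ₑ η) (there x)   = η x

Env-mono : ∀ {Γ Δ Δ′} → Δ ⊆ Δ′ → Env Γ Δ → Env Γ Δ′
Env-mono ρ η {A} x = ⟦⟧-mono A ρ (η x)

⟦⋁⟧-inj : ∀ {Γ} A B → ⟦ A ⟧ Γ ⊎ ⟦ B ⟧ Γ → ⟦ A ⋁ B ⟧ Γ
⟦⋁⟧-inj A B v C ρ κ = κ ⊆-refl (Sum.map (⟦⟧-mono A ρ) (⟦⟧-mono B ρ) v)

eval : ∀ {Γ Δ C} → Ded Γ C → Env Γ Δ → ⟦ C ⟧ Δ
eval (hyp x)                 η = η x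
eval (⋀I d₁ d₂ d₃)           η = eval d₃ ((eval d₁ η , eval d₂ η) ∷ₑ η)
eval {Δ = Δ} (⊃I {A} {B} d₁ d₂) η = eval d₂ ((λ {Δ′} → abstraction {Δ′}) ∷ₑ η)
  where
  abstraction : ⟦ A ⊃ B ⟧ Δ
  abstraction ρ a = eval d₁ (a ∷ₑ Env-mono ρ η)
eval (⋁I₁ {A} {B} d₁ d₂)     η = eval d₂ (⟦⋁⟧-inj A B (inj₁ (eval d₁ η)) ∷ₑ η)
eval (⋁I₂ {A} {B} d₁ d₂)     η = eval d₂ (⟦⋁⟧-inj A B (inj₂ (eval d₁ η)) ∷ₑ η)
eval (⋀E d₁ d₂)              η = eval d₂ (proj₁ (eval d₁ η) ∷ₑ proj₂ (eval d₁ η) ∷ₑ η)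
eval (⊃E d₁ d₂ d₃)           η = eval d₃ (eval d₁ η ⊆-refl (eval d₂ η) ∷ₑ η)
eval {Δ = Δ} {C} (⋁E {A} {B} d₁ d₂ d₃) η =
  collapse C (λ C′ ρ κ → eval d₁ η C′ ρ (λ σ v → κ σ (branch (⊆-trans ρ σ) v)))
  where
  branch : ∀ {Δ′} → Δ ⊆ Δ′ → ⟦ A ⟧ Δ′ ⊎ ⟦ B ⟧ Δ′ → ⟦ C ⟧ Δ′
  branch τ = [ (λ a → eval d₂ (a ∷ₑ Env-mono τ η)) , (λ b → eval d₃ (b ∷ₑ Env-mono τ η)) ]′
eval (⊥E n d)                η = collapse (atom n) (λ C ρ κ → eval d η C ρ (λ _ ()))

normalise : ∀ {Γ C} → Ded Γ C → Nf Γ C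
normalise {C = C} d = reify C (eval d (λ {A} → reflect A))

-- Cut-free derivations as normal deductions

embed : ∀ {Γ C} → Nf Γ C → Ded Γ C
embed (hyp x)    = hyp x
embed (⋀R a b)   = ⋀I (embed a) (embed b) (hyp (here refl))
embed (⊃R d)     = ⊃I (embed d) (hyp (here refl))
embed (⋁R₁ d)    = ⋁I₁ (embed d) (hyp (here refl))
embed (⋁R₂ d)    = ⋁I₂ (embed d) (hyp (here refl))
embed (⋀L x d)   = ⋀E (hyp x) (embed d)
embed (⊃L x a d) = ⊃E (hyp x) (embed a) (embed d)
embed (⋁L x d e) = ⋁E (hyp x) (embed d) (embed e)
embed (⊥L n x)   = ⊥E n (hyp x)

lookup-unmarked : ∀ {Γ A} (x : A ∈ Γ) → lookup (unmarked Γ) x ≢ true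
lookup-unmarked (here refl) ()
lookup-unmarked (there x)   = lookup-unmarked x

embed-noMaxFormula : ∀ {Γ C} (d : Nf Γ C) → ¬ HasMaxFormula (unmarked Γ) (embed d)
embed-noMaxFormula (⋀R a b)   (in-⋀I₁ h)  = embed-noMaxFormula a h
embed-noMaxFormula (⋀R a b)   (in-⋀I₂ h)  = embed-noMaxFormula b h
embed-noMaxFormula (⊃R d)     (in-⊃I₁ h)  = embed-noMaxFormula d h
embed-noMaxFormula (⋁R₁ d)    (in-⋁I₁₁ h) = embed-noMaxFormula d h
embed-noMaxFormula (⋁R₂ d)    (in-⋁I₂₁ h) = embed-noMaxFormula d h
embed-noMaxFormula (⋀L x d)   (mf-⋀E eq)  = lookup-unmarked x eq
embed-noMaxFormula (⋀L x d)   (in-⋀E₂ h)  = embed-noMaxFormula d h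
embed-noMaxFormula (⊃L x a d) (mf-⊃E eq)  = lookup-unmarked x eq
embed-noMaxFormula (⊃L x a d) (in-⊃E₂ h)  = embed-noMaxFormula a h
embed-noMaxFormula (⊃L x a d) (in-⊃E₃ h)  = embed-noMaxFormula d h
embed-noMaxFormula (⋁L x d e) (mf-⋁E eq)  = lookup-unmarked x eq
embed-noMaxFormula (⋁L x d e) (in-⋁E₂ h)  = embed-noMaxFormula d h
embed-noMaxFormula (⋁L x d e) (in-⋁E₃ h)  = embed-noMaxFormula e h
embed-noMaxFormula (⊥L n x)   (in-⊥E ())

¬SegmentEndingAt-hyp : ∀ {Γ A} (x : A ∈ Γ) → ¬ SegmentEndingAt {Γ} (hyp x)
¬SegmentEndingAt-hyp x (seg-two ())
¬SegmentEndingAt-hyp x (seg-more () _)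

embed-noMaxSegment : ∀ {Γ C} (d : Nf Γ C) → ¬ HasMaxSegment (embed d)
embed-noMaxSegment (⋀R a b)   (in-⋀I₁ h)  = embed-noMaxSegment a h
embed-noMaxSegment (⋀R a b)   (in-⋀I₂ h)  = embed-noMaxSegment b h
embed-noMaxSegment (⊃R d)     (in-⊃I₁ h)  = embed-noMaxSegment d h
embed-noMaxSegment (⋁R₁ d)    (in-⋁I₁₁ h) = embed-noMaxSegment d h
embed-noMaxSegment (⋁R₂ d)    (in-⋁I₂₁ h) = embed-noMaxSegment d h
embed-noMaxSegment (⋀L x d)   (ms-⋀E s)   = ¬SegmentEndingAt-hyp x s
embed-noMaxSegment (⋀L x d)   (in-⋀E₂ h)  = embed-noMaxSegment d h
embed-noMaxSegment (⊃L x a d) (ms-⊃E s)   = ¬SegmentEndingAt-hyp x s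
embed-noMaxSegment (⊃L x a d) (in-⊃E₂ h)  = embed-noMaxSegment a h
embed-noMaxSegment (⊃L x a d) (in-⊃E₃ h)  = embed-noMaxSegment d h
embed-noMaxSegment (⋁L x d e) (ms-⋁E s)   = ¬SegmentEndingAt-hyp x s
embed-noMaxSegment (⋁L x d e) (in-⋁E₂ h)  = embed-noMaxSegment d h
embed-noMaxSegment (⋁L x d e) (in-⋁E₃ h)  = embed-noMaxSegment e h
embed-noMaxSegment (⊥L n x)   (ms-⊥E s)   = ¬SegmentEndingAt-hyp x s

-- Removing vacuous discharges

rename-uses : ∀ {Γ Δ C A} (ρ : Γ ⊆ Δ) {y : A ∈ Γ} (d : Nf Γ C) →
              Uses y (embed d) → Uses (ρ y) (embed (rename ρ d))
rename-uses ρ (hyp x)    u-hyp              = u-hyp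
rename-uses ρ (⋀R a b)   (u-⋀I₁ u)          = u-⋀I₁ (rename-uses ρ a u)
rename-uses ρ (⋀R a b)   (u-⋀I₂ u)          = u-⋀I₂ (rename-uses ρ b u)
rename-uses ρ (⊃R d)     (u-⊃I₁ u)          = u-⊃I₁ (rename-uses (∷⁺ʳ _ ρ) d u)
rename-uses ρ (⋁R₁ d)    (u-⋁I₁₁ u)         = u-⋁I₁₁ (rename-uses ρ d u)
rename-uses ρ (⋁R₂ d)    (u-⋁I₂₁ u)         = u-⋁I₂₁ (rename-uses ρ d u)
rename-uses ρ (⋀L x d)   (u-⋀E₁ u-hyp)      = u-⋀E₁ u-hyp
rename-uses ρ (⋀L x d)   (u-⋀E₂ u)          = u-⋀E₂ (rename-uses (∷⁺ʳ _ (∷⁺ʳ _ ρ)) d u)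
rename-uses ρ (⊃L x a d) (u-⊃E₁ u-hyp)      = u-⊃E₁ u-hyp
rename-uses ρ (⊃L x a d) (u-⊃E₂ u)          = u-⊃E₂ (rename-uses ρ a u)
rename-uses ρ (⊃L x a d) (u-⊃E₃ u)          = u-⊃E₃ (rename-uses (∷⁺ʳ _ ρ) d u)
rename-uses ρ (⋁L x d e) (u-⋁E₁ u-hyp)      = u-⋁E₁ u-hyp
rename-uses ρ (⋁L x d e) (u-⋁E₂ u)          = u-⋁E₂ (rename-uses (∷⁺ʳ _ ρ) d u)
rename-uses ρ (⋁L x d e) (u-⋁E₃ u)          = u-⋁E₃ (rename-uses (∷⁺ʳ _ ρ) e u)
rename-uses ρ (⊥L n x)   (u-⊥E u-hyp)       = u-⊥E u-hyp

rename-noVac : ∀ {Γ Δ C} (ρ : Γ ⊆ Δ) (d : Nf Γ C) → NoVac (embed d) → NoVac (embed (rename ρ d))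
rename-noVac ρ (hyp x)    _                   = tt
rename-noVac ρ (⋀R a b)   (na , nb , _)       = rename-noVac ρ a na , rename-noVac ρ b nb , tt , u-hyp
rename-noVac ρ (⊃R d)     (nd , _)            = rename-noVac (∷⁺ʳ _ ρ) d nd , tt , u-hyp
rename-noVac ρ (⋁R₁ d)    (nd , _)            = rename-noVac ρ d nd , tt , u-hyp
rename-noVac ρ (⋁R₂ d)    (nd , _)            = rename-noVac ρ d nd , tt , u-hyp
rename-noVac ρ (⋀L x d)   (_ , nd , u)        =
  tt , rename-noVac ρ′ d nd , Sum.map (rename-uses ρ′ d) (rename-uses ρ′ d) u
  where ρ′ = ∷⁺ʳ _ (∷⁺ʳ _ ρ)
rename-noVac ρ (⊃L x a d) (_ , na , nd , u)   =
  tt , rename-noVac ρ a na , rename-noVac (∷⁺ʳ _ ρ) d nd , rename-uses (∷⁺ʳ _ ρ) d u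
rename-noVac ρ (⋁L x d e) (_ , nd , ne , u , v) =
  tt , rename-noVac (∷⁺ʳ _ ρ) d nd , rename-noVac (∷⁺ʳ _ ρ) e ne , rename-uses (∷⁺ʳ _ ρ) d u , rename-uses (∷⁺ʳ _ ρ) e v
rename-noVac ρ (⊥L n x)   _                   = tt

size : ∀ {Γ C} → Nf Γ C → ℕ
size (hyp x)    = 0
size (⋀R a b)   = suc (size a + size b)
size (⊃R d)     = suc (size d)
size (⋁R₁ d)    = suc (size d)
size (⋁R₂ d)    = suc (size d)
size (⋀L x d)   = suc (size d)
size (⊃L x a d) = suc (size a + size d)
size (⋁L x d e) = suc (size d + size e)
size (⊥L n x)   = 0

size-rename : ∀ {Γ Δ C} (ρ : Γ ⊆ Δ) (d : Nf Γ C) → size (rename ρ d) ≡ size d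
size-rename ρ (hyp x)    = refl
size-rename ρ (⋀R a b)   = cong suc (cong₂ _+_ (size-rename ρ a) (size-rename ρ b))
size-rename ρ (⊃R d)     = cong suc (size-rename (∷⁺ʳ _ ρ) d)
size-rename ρ (⋁R₁ d)    = cong suc (size-rename ρ d)
size-rename ρ (⋁R₂ d)    = cong suc (size-rename ρ d)
size-rename ρ (⋀L x d)   = cong suc (size-rename (∷⁺ʳ _ (∷⁺ʳ _ ρ)) d)
size-rename ρ (⊃L x a d) = cong suc (cong₂ _+_ (size-rename ρ a) (size-rename (∷⁺ʳ _ ρ) d))
size-rename ρ (⋁L x d e) = cong suc (cong₂ _+_ (size-rename (∷⁺ʳ _ ρ) d) (size-rename (∷⁺ʳ _ ρ) e))
size-rename ρ (⊥L n x)   = refl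

∈-strengthen : ∀ {Γ A B} (y : A ∈ Γ) (x : B ∈ Γ) → Uses y (Ded.hyp x) ⊎ B ∈ (Γ ─ y)
∈-strengthen (here refl) (here refl) = inj₁ u-hyp
∈-strengthen (here refl) (there x)   = inj₂ x
∈-strengthen (there y)   (here refl) = inj₂ (here refl)
∈-strengthen (there y)   (there x)   with ∈-strengthen y x
... | inj₁ u-hyp = inj₁ u-hyp
... | inj₂ z     = inj₂ (there z)

Strengthening : ∀ {Γ A C} → A ∈ Γ → Nf Γ C → Set
Strengthening {Γ} {C = C} y d = Uses y (embed d) ⊎ Σ (Nf (Γ ─ y) C) (λ e → size e ≡ size d)

strengthen : ∀ {Γ A C} (y : A ∈ Γ) (d : Nf Γ C) → Strengthening y d
strengthen y (hyp x) with ∈-strengthen y x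
... | inj₁ u = inj₁ u
... | inj₂ z = inj₂ (hyp z , refl)
strengthen y (⋀R a b) with strengthen y a | strengthen y b
... | inj₁ u        | _             = inj₁ (u-⋀I₁ u)
... | inj₂ _        | inj₁ u        = inj₁ (u-⋀I₂ u)
... | inj₂ (a′ , p) | inj₂ (b′ , q) = inj₂ (⋀R a′ b′ , cong suc (cong₂ _+_ p q))
strengthen y (⊃R d) with strengthen (there y) d
... | inj₁ u        = inj₁ (u-⊃I₁ u)
... | inj₂ (d′ , p) = inj₂ (⊃R d′ , cong suc p)
strengthen y (⋁R₁ d) with strengthen y d
... | inj₁ u        = inj₁ (u-⋁I₁₁ u)
... | inj₂ (d′ , p) = inj₂ (⋁R₁ d′ , cong suc p)
strengthen y (⋁R₂ d) with strengthen y d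
... | inj₁ u        = inj₁ (u-⋁I₂₁ u)
... | inj₂ (d′ , p) = inj₂ (⋁R₂ d′ , cong suc p)
strengthen y (⋀L x d) with ∈-strengthen y x | strengthen (there (there y)) d
... | inj₁ u  | _             = inj₁ (u-⋀E₁ u)
... | inj₂ _  | inj₁ u        = inj₁ (u-⋀E₂ u)
... | inj₂ x′ | inj₂ (d′ , p) = inj₂ (⋀L x′ d′ , cong suc p)
strengthen y (⊃L x a d) with ∈-strengthen y x | strengthen y a | strengthen (there y) d
... | inj₁ u  | _             | _             = inj₁ (u-⊃E₁ u)
... | inj₂ _  | inj₁ u        | _             = inj₁ (u-⊃E₂ u)
... | inj₂ _  | inj₂ _        | inj₁ u        = inj₁ (u-⊃E₃ u)
... | inj₂ x′ | inj₂ (a′ , p) | inj₂ (d′ , q) = inj₂ (⊃L x′ a′ d′ , cong suc (cong₂ _+_ p q))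
strengthen y (⋁L x d e) with ∈-strengthen y x | strengthen (there y) d | strengthen (there y) e
... | inj₁ u  | _             | _             = inj₁ (u-⋁E₁ u)
... | inj₂ _  | inj₁ u        | _             = inj₁ (u-⋁E₂ u)
... | inj₂ _  | inj₂ _        | inj₁ u        = inj₁ (u-⋁E₃ u)
... | inj₂ x′ | inj₂ (d′ , p) | inj₂ (e′ , q) = inj₂ (⋁L x′ d′ e′ , cong suc (cong₂ _+_ p q))
strengthen y (⊥L n x) with ∈-strengthen y x
... | inj₁ u = inj₁ (u-⊥E u)
... | inj₂ z = inj₂ (⊥L n z , refl)

Pruned : List Formula → Formula → ℕ → Set
Pruned Γ C k = Σ (Nf Γ C) (λ e → NoVac (embed e) × size e ≤ k)

Pruned-weaken : ∀ {Γ C k l} → k ≤ l → Pruned Γ C k → Pruned Γ C l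
Pruned-weaken k≤l (e , nv , q) = e , nv , ≤-trans q k≤l

-- Non-vacuity is not tracked through strengthening, so a strengthened
-- derivation is pruned again; the fuel n bounds the size, which
-- strengthening preserves.
mutual
  prune : ∀ {Γ C} n (d : Nf Γ C) → size d ≤ n → Pruned Γ C (size d)
  prune n       (hyp x)    _       = hyp x , tt , ≤-refl
  prune n       (⊥L m x)   _       = ⊥L m x , tt , ≤-refl
  prune (suc n) (⋀R a b)   (s≤s p) with prune n a (m+n≤o⇒m≤o _ p) | prune n b (m+n≤o⇒n≤o _ p)
  ... | a′ , na , qa | b′ , nb , qb = ⋀R a′ b′ , (na , nb , tt , u-hyp) , s≤s (+-mono-≤ qa qb)
  prune (suc n) (⊃R d)     (s≤s p) with prune n d p
  ... | d′ , nd , q = ⊃R d′ , (nd , tt , u-hyp) , s≤s q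
  prune (suc n) (⋁R₁ d)    (s≤s p) with prune n d p
  ... | d′ , nd , q = ⋁R₁ d′ , (nd , tt , u-hyp) , s≤s q
  prune (suc n) (⋁R₂ d)    (s≤s p) with prune n d p
  ... | d′ , nd , q = ⋁R₂ d′ , (nd , tt , u-hyp) , s≤s q
  prune (suc n) (⋀L x d)   (s≤s p) with prune n d p
  ... | d′ , nd , qd with pruneWithout n (here refl) d′ (≤-trans qd p)
  ...   | inj₁ u = ⋀L x d′ , (tt , nd , inj₁ u) , s≤s qd
  ...   | inj₂ (e , ne , qe) with pruneWithout n (here refl) e (≤-trans qe (≤-trans qd p))
  ...     | inj₁ u = ⋀L x (rename there e) , (tt , rename-noVac there e ne , inj₂ (rename-uses there e u))
                   , s≤s (≤-trans (≤-reflexive (size-rename there e)) (≤-trans qe qd))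
  ...     | inj₂ f = Pruned-weaken (m≤n⇒m≤1+n (≤-trans qe qd)) f
  prune (suc n) (⊃L x a d) (s≤s p) with prune n a (m+n≤o⇒m≤o _ p) | prune n d (m+n≤o⇒n≤o _ p)
  ... | a′ , na , qa | d′ , nd , qd with pruneWithout n (here refl) d′ (≤-trans qd (m+n≤o⇒n≤o _ p))
  ...   | inj₁ u = ⊃L x a′ d′ , (tt , na , nd , u) , s≤s (+-mono-≤ qa qd)
  ...   | inj₂ f = Pruned-weaken (m≤n⇒m≤1+n (≤-trans qd (m≤n+m _ _))) f
  prune (suc n) (⋁L x d e) (s≤s p) with prune n d (m+n≤o⇒m≤o _ p) | prune n e (m+n≤o⇒n≤o _ p)
  ... | d′ , nd , qd | e′ , ne , qe
      with pruneWithout n (here refl) d′ (≤-trans qd (m+n≤o⇒m≤o _ p))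
         | pruneWithout n (here refl) e′ (≤-trans qe (m+n≤o⇒n≤o _ p))
  ...   | inj₂ f | _      = Pruned-weaken (m≤n⇒m≤1+n (≤-trans qd (m≤m+n _ _))) f
  ...   | inj₁ _ | inj₂ f = Pruned-weaken (m≤n⇒m≤1+n (≤-trans qe (m≤n+m _ _))) f
  ...   | inj₁ u | inj₁ v = ⋁L x d′ e′ , (tt , nd , ne , u , v) , s≤s (+-mono-≤ qd qe)

  pruneWithout : ∀ {Γ A C} n (y : A ∈ Γ) (d : Nf Γ C) → size d ≤ n →
                 Uses y (embed d) ⊎ Pruned (Γ ─ y) C (size d)
  pruneWithout n y d p with strengthen y d
  ... | inj₁ u       = inj₁ u
  ... | inj₂ (e , r) = inj₂ (Pruned-weaken (≤-reflexive r) (prune n e (≤-trans (≤-reflexive r) p)))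

corollary1 : (Γ : List Formula) (A : Formula) (d : Ded Γ A) → NoVac d →
    Σ (Ded Γ A) (λ d′ → NoVac d′ × Normal d′)
-- Normalisation does not need the standing convention on d.
corollary1 Γ A d _ =
  let e , noVac , _ = prune _ (normalise d) ≤-refl
  in embed e , noVac , embed-noMaxFormula e , embed-noMaxSegment e
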